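{- Every saturated intersection type theory is sensible; that is, if $\mathcal{T}=\langle\mathbb{A},\leq_{\mathcal{T}}\rangle$ is an itt for which there is an $\mathbb{A}$-environment $\zeta$ such that (i) $[\![A]\!]_\zeta=\Lambda$ if and only if $A\sim_{\mathcal{T}}{\sf U}$, and (ii) $A\leq_{\mathcal{T}}B$ implies $[\![A]\!]_\zeta\subseteq[\![B]\!]_\zeta$, then for every unsolvable term $M$, basis $\Gamma$ and type $A$, $\Gamma\vdash_{\mathcal{T}} M:A$ implies $A\sim_{\mathcal{T}}{\sf U}$.
   Context: Intersection types over constants $\mathbb{A}$ and ${\sf U}$: $A::={\sf c}\mid{\sf U}\mid A\to A\mid A\cap A$. A subtyping relation $\leq$ is closed under: $A\leq A$; $B\cap A\leq B$; $B\cap A\leq A$; $A\leq{\sf U}$; $B\leq A, B\leq A'\Rightarrow B\leq A\cap A'$; transitivity; $B'\sim B, A\sim A'\Rightarrow B\to A\sim B'\to A'$ ($A\sim B$ means $A\leq B$ and $B\leq A$). An itt is $\mathcal{T}=\langle\mathbb{A},\leq_{\mathcal{T}}\rangle$. Type assignment $\Gamma\vdash_{\mathcal{T}}M:A$ ($\Gamma$ finite map from variables to types) is given by: $\Gamma,x:A\vdash x:A$; $\Gamma\vdash M:{\sf U}$; $\to$-introduction ($\Gamma,x:B\vdash M:A$ gives $\Gamma\vdash\lambda x.M:B\to A$); $\to$-elimination; $\cap$-introduction; subsumption along $\leq_{\mathcal{T}}$. A term is unsolvable if its head reduction is infinite. $\mathcal{S}$ is the set of solvable terms, $\mathcal{B}=\{M\mid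 M\to^*_\beta xM_1\cdots M_m\}$; a set $X\subseteq\mathcal{S}$ is saturated if closed under $\beta$-conversion and containing all $xM_1\cdots M_m$. $\mathcal{S\!\Lambda}$ is the set of saturated $X$ with $\mathcal{B}\subseteq X\subseteq\mathcal{S}$ together with $\Lambda$ (all terms). $X\Rightarrow Y=\{M\mid\forall N\in X.\ MN\in Y\}$. An $\mathbb{A}$-environment is a map $\zeta:\mathbb{A}\to\mathcal{S\!\Lambda}$; its type interpretation is $[\![{\sf U}]\!]_\zeta=\Lambda$, $[\![{\sf c}]\!]_\zeta=\zeta({\sf c})$, $[\![A\to B]\!]_\zeta=[\![A]\!]_\zeta\Rightarrow[\![B]\!]_\zeta$, $[\![A\cap B]\!]_\zeta=[\![A]\!]_\zeta\cap[\![B]\!]_\zeta$. An itt is saturated if some type interpretation induces an embedding (in the sense of conditions (i),(ii) above, together with automatic preservation of $\to$ and $\cap$) of the gitt of $\sim_{\mathcal{T}}$-classes into $\langle\mathcal{S\!\Lambda},\subseteq\rangle$. -}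

module Defs where

open import Data.Nat using (ℕ; zero; suc)
open import Data.List using (List; []; _∷_; foldl)
open import Data.Maybe using (Maybe; just; nothing)
open import Data.Product using (Σ; _×_; _,_; ∃)
open import Data.Sum using (_⊎_)
open import Data.Unit using (⊤)
open import Relation.Nullary using (¬_)
open import Relation.Binary.PropositionalEquality using (_≡_)
open import Relation.Binary.Construct.Closure.ReflexiveTransitive using (Star)
open import Relation.Binary.Construct.Closure.Equivalence using (EqClosure)

-- Untyped λ-terms (de Bruijn indices; free variables are the indices
-- not bound by an enclosing λ)

data Term : Set where
  var : ℕ → Term
  lam : Term → Term
  app : Term → Term → Term

apps : Term → List Term → Term
apps = foldl app

ext : (ℕ → ℕ) → ℕ → ℕ
ext ρ zero    = zero
ext ρ (suc i) = suc (ρ i)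

rename : (ℕ → ℕ) → Term → Term
rename ρ (var i)   = var (ρ i)
rename ρ (lam M)   = lam (rename (ext ρ) M)
rename ρ (app M N) = app (rename ρ M) (rename ρ N)

exts : (ℕ → Term) → ℕ → Term
exts σ zero    = var zero
exts σ (suc i) = rename suc (σ i)

subst : (ℕ → Term) → Term → Term
subst σ (var i)   = σ i
subst σ (lam M)   = lam (subst (exts σ) M)
subst σ (app M N) = app (subst σ M) (subst σ N)

sub0 : Term → ℕ → Term
sub0 Q zero    = Q
sub0 Q (suc i) = var i

_[_] : Term → Term → Term
P [ Q ] = subst (sub0 Q) P

data _→β_ : Term → Term → Set where
  β    : ∀ {P Q} → app (lam P) Q →β (P [ Q ])
  ξlam : ∀ {M N} → M →β N → lam M →β lam N
  ξappL : ∀ {M N Q} → M →β N → app M Q →β app N Q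
  ξappR : ∀ {M N Q} → M →β N → app Q M →β app Q N

_→β*_ : Term → Term → Set
_→β*_ = Star _→β_

_=β_ : Term → Term → Set
_=β_ = EqClosure _→β_

-- Head reduction:  λx⃗.(λy.P) Q R⃗  →h  λx⃗. P[Q/y] R⃗

data _→h_ : Term → Term → Set where
  hβ   : ∀ {P Q} → app (lam P) Q →h (P [ Q ])
  hlam : ∀ {M N} → M →h N → lam M →h lam N
  happ : ∀ {M₁ M₂ N Q} → app M₁ M₂ →h N → app (app M₁ M₂) Q →h app N Q

-- M is unsolvable: its head reduction is infinite
Unsolvable : Term → Set
Unsolvable M = Σ (ℕ → Term) λ f → (f zero ≡ M) × (∀ i → f i →h f (suc i))

Solvable : Term → Set
Solvable M = ¬ Unsolvable M

TSet : Set₁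
TSet = Term → Set

_⊆_ : TSet → TSet → Set
X ⊆ Y = ∀ M → X M → Y M

Λ : TSet
Λ _ = ⊤

IsΛ : TSet → Set
IsΛ X = ∀ M → X M

𝒮 : TSet
𝒮 = Solvable

ℬ : TSet
ℬ M = Σ ℕ λ x → Σ (List Term) λ Ms → M →β* apps (var x) Ms

-- saturated: closed under β-conversion and containing all x M₁ ⋯ Mₘ
-- (the requirement X ⊆ 𝒮 is imposed separately in 𝒮Λ below)
SaturatedSet : TSet → Set
SaturatedSet X =
  (∀ M N → X M → M =β N → X N) × (∀ x Ms → X (apps (var x) Ms))

In𝒮Λ : TSet → Set
In𝒮Λ X = IsΛ X ⊎ (SaturatedSet X × (ℬ ⊆ X) × (X ⊆ 𝒮))

_⇛_ : TSet → TSet → TSet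
(X ⇛ Y) M = ∀ N → X N → Y (app M N)

_∩ₛ_ : TSet → TSet → TSet
(X ∩ₛ Y) M = X M × Y M

infixr 7 _⇒_
infixl 8 _∩_

data Ty (𝔸 : Set) : Set where
  at  : 𝔸 → Ty 𝔸
  U   : Ty 𝔸
  _⇒_ : Ty 𝔸 → Ty 𝔸 → Ty 𝔸
  _∩_ : Ty 𝔸 → Ty 𝔸 → Ty 𝔸

Sym∧ : {A : Set} → (A → A → Set) → A → A → Set
Sym∧ R a b = R a b × R b a

record ITT : Set₁ where
  field
    𝔸   : Set
    _≤_ : Ty 𝔸 → Ty 𝔸 → Set
    ≤-refl  : ∀ A → A ≤ A
    ∩-≤ˡ    : ∀ A B → (B ∩ A) ≤ B
    ∩-≤ʳ    : ∀ A B → (B ∩ A) ≤ A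
    ≤-U     : ∀ A → A ≤ U
    ∩-glb   : ∀ {A A′ B} → B ≤ A → B ≤ A′ → B ≤ (A ∩ A′)
    ≤-trans : ∀ {A B C} → A ≤ B → B ≤ C → A ≤ C
    ⇒-cong  : ∀ {A A′ B B′} → Sym∧ _≤_ B′ B → Sym∧ _≤_ A A′ →
              Sym∧ _≤_ (B ⇒ A) (B′ ⇒ A′)

  _∼_ : Ty 𝔸 → Ty 𝔸 → Set
  _∼_ = Sym∧ _≤_

  -- bases: Γ = x₀:A₀, x₁:A₁, … (de Bruijn); variable i ∉ dom Γ if i ≥ length Γ
  Basis : Set
  Basis = List (Ty 𝔸)

  lookupB : Basis → ℕ → Maybe (Ty 𝔸)
  lookupB []      _       = nothing
  lookupB (A ∷ Γ) zero    = just A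
  lookupB (A ∷ Γ) (suc i) = lookupB Γ i

  data _⊢_∶_ : Basis → Term → Ty 𝔸 → Set where
    ax    : ∀ {Γ i A} → lookupB Γ i ≡ just A → Γ ⊢ var i ∶ A
    U-top : ∀ {Γ M} → Γ ⊢ M ∶ U
    ⇒I    : ∀ {Γ M A B} → (B ∷ Γ) ⊢ M ∶ A → Γ ⊢ lam M ∶ (B ⇒ A)
    ⇒E    : ∀ {Γ M N A B} → Γ ⊢ M ∶ (B ⇒ A) → Γ ⊢ N ∶ B → Γ ⊢ app M N ∶ A
    ∩I    : ∀ {Γ M A B} → Γ ⊢ M ∶ A → Γ ⊢ M ∶ B → Γ ⊢ M ∶ (A ∩ B)
    ≤E    : ∀ {Γ M A B} → Γ ⊢ M ∶ A → A ≤ B → Γ ⊢ M ∶ B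

  record Env : Set₁ where
    field
      ζ    : 𝔸 → TSet
      ζ-ok : ∀ c → In𝒮Λ (ζ c)

  ⟦_⟧ : Ty 𝔸 → Env → TSet
  ⟦ at c  ⟧ e = Env.ζ e c
  ⟦ U     ⟧ e = Λ
  ⟦ A ⇒ B ⟧ e = ⟦ A ⟧ e ⇛ ⟦ B ⟧ e
  ⟦ A ∩ B ⟧ e = ⟦ A ⟧ e ∩ₛ ⟦ B ⟧ e

  IsSaturated : Set₁
  IsSaturated = Σ Env λ e →
    (∀ A → (IsΛ (⟦ A ⟧ e) → A ∼ U) × (A ∼ U → IsΛ (⟦ A ⟧ e))) ×
    (∀ A B → A ≤ B → ⟦ A ⟧ e ⊆ ⟦ B ⟧ e)

  IsSensible : Set
  IsSensible = ∀ M Γ A → Unsolvable M → Γ ⊢ M ∶ A → A ∼ U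

{-# OPTIONS --safe #-}
module Submission where

-- Type assignment is sound for the interpretation: if Γ ⊢ M ∶ A then M ∈ ⟦ A ⟧,
-- since variables, being head normal forms, lie in every ⟦ B ⟧. Moreover every
-- ⟦ A ⟧ is either Λ or consists of solvable terms only; for X ⇛ Y this holds
-- because M x ∈ Y for a variable x ∈ X, and M x is unsolvable whenever M is.
-- Hence an unsolvable term can only have types A with ⟦ A ⟧ = Λ, i.e. A ∼ U.

open import Defs
open import Data.List using ([]; _∷_; _∷ʳ_)
open import Data.List.Properties using (foldl-∷ʳ)
open import Data.Maybe using (just)
open import Data.Maybe.Properties using (just-injective)
open import Data.Nat using (ℕ; zero; suc)
open import Data.Product using (_,_; proj₁; proj₂)
open import Data.Sum using (_⊎_; inj₁; inj₂; [_,_]′)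
open import Data.Unit using (tt)
open import Data.Empty using (⊥-elim)
open import Function using (_∘_)
open import Relation.Binary.PropositionalEquality
  using (_≡_; _≗_; refl; sym; trans; cong; cong₂)
  renaming (subst to transport)
open import Relation.Binary.Construct.Closure.ReflexiveTransitive using (ε; _◅_)
open import Relation.Binary.Construct.Closure.Symmetric using (bwd)
import Relation.Binary.Construct.Closure.Equivalence as EqClosure

ext-cong : ∀ {ρ ρ′} → ρ ≗ ρ′ → ext ρ ≗ ext ρ′
ext-cong ρ≗ρ′ zero    = refl
ext-cong ρ≗ρ′ (suc i) = cong suc (ρ≗ρ′ i)

rename-cong : ∀ {ρ ρ′} → ρ ≗ ρ′ → ∀ M → rename ρ M ≡ rename ρ′ M
rename-cong ρ≗ρ′ (var i)   = cong var (ρ≗ρ′ i)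
rename-cong ρ≗ρ′ (lam M)   = cong lam (rename-cong (ext-cong ρ≗ρ′) M)
rename-cong ρ≗ρ′ (app M N) = cong₂ app (rename-cong ρ≗ρ′ M) (rename-cong ρ≗ρ′ N)

exts-cong : ∀ {σ σ′} → σ ≗ σ′ → exts σ ≗ exts σ′
exts-cong σ≗σ′ zero    = refl
exts-cong σ≗σ′ (suc i) = cong (rename suc) (σ≗σ′ i)

subst-cong : ∀ {σ σ′} → σ ≗ σ′ → ∀ M → subst σ M ≡ subst σ′ M
subst-cong σ≗σ′ (var i)   = σ≗σ′ i
subst-cong σ≗σ′ (lam M)   = cong lam (subst-cong (exts-cong σ≗σ′) M)
subst-cong σ≗σ′ (app M N) = cong₂ app (subst-cong σ≗σ′ M) (subst-cong σ≗σ′ N)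

ext-∘ : ∀ ρ ρ′ → ext ρ ∘ ext ρ′ ≗ ext (ρ ∘ ρ′)
ext-∘ ρ ρ′ zero    = refl
ext-∘ ρ ρ′ (suc i) = refl

rename-∘ : ∀ ρ ρ′ M → rename ρ (rename ρ′ M) ≡ rename (ρ ∘ ρ′) M
rename-∘ ρ ρ′ (var i)   = refl
rename-∘ ρ ρ′ (lam M)   =
  cong lam (trans (rename-∘ (ext ρ) (ext ρ′) M) (rename-cong (ext-∘ ρ ρ′) M))
rename-∘ ρ ρ′ (app M N) = cong₂ app (rename-∘ ρ ρ′ M) (rename-∘ ρ ρ′ N)

exts-ext : ∀ τ ρ → exts τ ∘ ext ρ ≗ exts (τ ∘ ρ)
exts-ext τ ρ zero    = refl
exts-ext τ ρ (suc i) = refl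

subst-rename : ∀ τ ρ M → subst τ (rename ρ M) ≡ subst (τ ∘ ρ) M
subst-rename τ ρ (var i)   = refl
subst-rename τ ρ (lam M)   =
  cong lam (trans (subst-rename (exts τ) (ext ρ) M) (subst-cong (exts-ext τ ρ) M))
subst-rename τ ρ (app M N) = cong₂ app (subst-rename τ ρ M) (subst-rename τ ρ N)

ext-exts : ∀ ρ σ → rename (ext ρ) ∘ exts σ ≗ exts (rename ρ ∘ σ)
ext-exts ρ σ zero    = refl
ext-exts ρ σ (suc i) = trans (rename-∘ (ext ρ) suc (σ i)) (sym (rename-∘ suc ρ (σ i)))

rename-subst : ∀ ρ σ M → rename ρ (subst σ M) ≡ subst (rename ρ ∘ σ) M
rename-subst ρ σ (var i)   = refl
rename-subst ρ σ (lam M)   =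
  cong lam (trans (rename-subst (ext ρ) (exts σ) M) (subst-cong (ext-exts ρ σ) M))
rename-subst ρ σ (app M N) = cong₂ app (rename-subst ρ σ M) (rename-subst ρ σ N)

exts-∘ : ∀ τ σ → subst (exts τ) ∘ exts σ ≗ exts (subst τ ∘ σ)
exts-∘ τ σ zero    = refl
exts-∘ τ σ (suc i) = trans (subst-rename (exts τ) suc (σ i)) (sym (rename-subst suc τ (σ i)))

subst-∘ : ∀ τ σ M → subst τ (subst σ M) ≡ subst (subst τ ∘ σ) M
subst-∘ τ σ (var i)   = refl
subst-∘ τ σ (lam M)   =
  cong lam (trans (subst-∘ (exts τ) (exts σ) M) (subst-cong (exts-∘ τ σ) M))
subst-∘ τ σ (app M N) = cong₂ app (subst-∘ τ σ M) (subst-∘ τ σ N)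

exts-var : exts var ≗ var
exts-var zero    = refl
exts-var (suc i) = refl

subst-var : ∀ M → subst var M ≡ M
subst-var (var i)   = refl
subst-var (lam M)   = cong lam (trans (subst-cong exts-var M) (subst-var M))
subst-var (app M N) = cong₂ app (subst-var M) (subst-var N)

infixr 5 _∷ₛ_

_∷ₛ_ : Term → (ℕ → Term) → ℕ → Term
(N ∷ₛ σ) zero    = N
(N ∷ₛ σ) (suc i) = σ i

exts-[] : ∀ σ N M → subst (exts σ) M [ N ] ≡ subst (N ∷ₛ σ) M
exts-[] σ N M = trans (subst-∘ (sub0 N) (exts σ) M) (subst-cong sub0-exts M)
  where
  sub0-exts : subst (sub0 N) ∘ exts σ ≗ N ∷ₛ σ
  sub0-exts zero    = refl
  sub0-exts (suc i) = trans (subst-rename (sub0 N) suc (σ i)) (subst-var (σ i))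

subst-[] : ∀ σ P Q → subst σ (P [ Q ]) ≡ subst (exts σ) P [ subst σ Q ]
subst-[] σ P Q =
  trans (subst-∘ σ (sub0 Q) P)
        (trans (subst-cong subst-sub0 P) (sym (exts-[] σ (subst σ Q) P)))
  where
  subst-sub0 : subst σ ∘ sub0 Q ≗ subst σ Q ∷ₛ σ
  subst-sub0 zero    = refl
  subst-sub0 (suc i) = refl

subst-→h : ∀ σ {M N} → M →h N → subst σ M →h subst σ N
subst-→h σ (hβ {P} {Q}) rewrite subst-[] σ P Q = hβ
subst-→h σ (hlam M→N)   = hlam (subst-→h (exts σ) M→N)
subst-→h σ (happ M→N)   = happ (subst-→h σ M→N)

module _ {N : Term} where

  -- When T is an abstraction the redex with N is contracted at once; this keeps
  -- the head reduction of app M N in lockstep with that of M.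
  app-reduct : Term → Term → Term
  app-reduct (lam P)   T′ = P [ N ]
  app-reduct (var _)   T′ = app T′ N
  app-reduct (app _ _) T′ = app T′ N

  app-→h : ∀ {T T′} → T →h T′ → app T N →h app-reduct T T′
  app-→h hβ       = happ hβ
  app-→h (hlam _) = hβ
  app-→h (happ r) = happ (happ r)

  app-reduct-→h : ∀ {T T′ T″} → T →h T′ → T′ →h T″ →
                  app-reduct T T′ →h app-reduct T′ T″
  app-reduct-→h hβ       r′       = app-→h r′
  app-reduct-→h (hlam r) (hlam _) = subst-→h (sub0 N) r
  app-reduct-→h (happ _) r′       = app-→h r′

  unsolvable-app : ∀ {M} → Unsolvable M → Unsolvable (app M N)
  unsolvable-app (f , f0≡M , f→h) = g , cong (λ T → app T N) f0≡M , g→h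
    where
    g : ℕ → Term
    g zero    = app (f zero) N
    g (suc i) = app-reduct (f i) (f (suc i))

    g→h : ∀ i → g i →h g (suc i)
    g→h zero    = app-→h (f→h zero)
    g→h (suc i) = app-reduct-→h (f→h i) (f→h (suc i))

-- The condition ℬ ⊆ X of 𝒮Λ is dropped; it follows from the other two.
record Candidate (X : TSet) : Set where
  field
    =β-closed  : ∀ M N → X M → M =β N → X N
    neutral    : ∀ x Ms → X (apps (var x) Ms)
    Λ-or-⊆𝒮   : IsΛ X ⊎ X ⊆ 𝒮

  β-expand : ∀ {P Q} → X (P [ Q ]) → X (app (lam P) Q)
  β-expand XP[Q] = =β-closed _ _ XP[Q] (bwd β ◅ ε)

  var∈ : ∀ x → X (var x)
  var∈ x = neutral x []

open Candidate

Λ-candidate : Candidate Λ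
Λ-candidate = record
  { =β-closed = λ _ _ _ _ → tt
  ; neutral   = λ _ _ → tt
  ; Λ-or-⊆𝒮  = inj₁ (λ _ → tt)
  }

In𝒮Λ⇒candidate : ∀ {X} → In𝒮Λ X → Candidate X
In𝒮Λ⇒candidate (inj₁ X≡Λ) = record
  { =β-closed = λ _ N _ _ → X≡Λ N
  ; neutral   = λ _ _ → X≡Λ _
  ; Λ-or-⊆𝒮  = inj₁ X≡Λ
  }
In𝒮Λ⇒candidate (inj₂ ((closed , neutral) , _ , X⊆𝒮)) = record
  { =β-closed = closed
  ; neutral   = neutral
  ; Λ-or-⊆𝒮  = inj₂ X⊆𝒮
  }

⇛-candidate : ∀ {X Y} → Candidate X → Candidate Y → Candidate (X ⇛ Y)
⇛-candidate {X} {Y} cX cY = record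
  { =β-closed = λ M M′ XY-M M=M′ N XN →
      =β-closed cY _ _ (XY-M N XN) (EqClosure.gmap (λ T → app T N) ξappL M=M′)
  ; neutral   = λ x Ms N _ →
      transport Y (foldl-∷ʳ app (var x) N Ms) (neutral cY x (Ms ∷ʳ N))
  ; Λ-or-⊆𝒮  = [Λ-or-⊆𝒮] (Λ-or-⊆𝒮 cY)
  }
  where
  [Λ-or-⊆𝒮] : IsΛ Y ⊎ Y ⊆ 𝒮 → IsΛ (X ⇛ Y) ⊎ (X ⇛ Y) ⊆ 𝒮
  [Λ-or-⊆𝒮] (inj₁ Y≡Λ) = inj₁ (λ M N _ → Y≡Λ (app M N))
  [Λ-or-⊆𝒮] (inj₂ Y⊆𝒮) =
    inj₂ (λ M XY-M M-uns → Y⊆𝒮 _ (XY-M (var 0) (var∈ cX 0)) (unsolvable-app M-uns))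

∩-candidate : ∀ {X Y} → Candidate X → Candidate Y → Candidate (X ∩ₛ Y)
∩-candidate {X} {Y} cX cY = record
  { =β-closed = λ M N (XM , YM) M=N → =β-closed cX M N XM M=N , =β-closed cY M N YM M=N
  ; neutral   = λ x Ms → neutral cX x Ms , neutral cY x Ms
  ; Λ-or-⊆𝒮  = [Λ-or-⊆𝒮] (Λ-or-⊆𝒮 cX) (Λ-or-⊆𝒮 cY)
  }
  where
  [Λ-or-⊆𝒮] : IsΛ X ⊎ X ⊆ 𝒮 → IsΛ Y ⊎ Y ⊆ 𝒮 → IsΛ (X ∩ₛ Y) ⊎ (X ∩ₛ Y) ⊆ 𝒮
  [Λ-or-⊆𝒮] (inj₁ X≡Λ) (inj₁ Y≡Λ) = inj₁ (λ M → X≡Λ M , Y≡Λ M)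
  [Λ-or-⊆𝒮] (inj₂ X⊆𝒮) _          = inj₂ (λ M → X⊆𝒮 M ∘ proj₁)
  [Λ-or-⊆𝒮] (inj₁ _)   (inj₂ Y⊆𝒮) = inj₂ (λ M → Y⊆𝒮 M ∘ proj₂)

module Interpretation (𝒯 : ITT) (e : ITT.Env 𝒯) where
  open ITT 𝒯

  ⟦⟧-candidate : ∀ A → Candidate (⟦ A ⟧ e)
  ⟦⟧-candidate (at c)  = In𝒮Λ⇒candidate (Env.ζ-ok e c)
  ⟦⟧-candidate U       = Λ-candidate
  ⟦⟧-candidate (A ⇒ B) = ⇛-candidate (⟦⟧-candidate A) (⟦⟧-candidate B)
  ⟦⟧-candidate (A ∩ B) = ∩-candidate (⟦⟧-candidate A) (⟦⟧-candidate B)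

  _⊨_ : (ℕ → Term) → Basis → Set
  σ ⊨ Γ = ∀ i B → lookupB Γ i ≡ just B → ⟦ B ⟧ e (σ i)

  ∷ₛ-⊨ : ∀ {σ Γ B N} → σ ⊨ Γ → ⟦ B ⟧ e N → (N ∷ₛ σ) ⊨ (B ∷ Γ)
  ∷ₛ-⊨ σ⊨Γ BN zero    _ B′≡B rewrite just-injective B′≡B = BN
  ∷ₛ-⊨ σ⊨Γ BN (suc i) = σ⊨Γ i

  var-⊨ : ∀ Γ → var ⊨ Γ
  var-⊨ Γ i B _ = var∈ (⟦⟧-candidate B) i

  module _ (≤⇒⊆ : ∀ A B → A ≤ B → ⟦ A ⟧ e ⊆ ⟦ B ⟧ e) where

    ⊢-sound : ∀ {Γ M A σ} → Γ ⊢ M ∶ A → σ ⊨ Γ → ⟦ A ⟧ e (subst σ M)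
    ⊢-sound (ax {i = i} {A} Γi≡A)       σ⊨Γ = σ⊨Γ i A Γi≡A
    ⊢-sound U-top                       σ⊨Γ = tt
    ⊢-sound {σ = σ} (⇒I {M = M} {A} ⊢M) σ⊨Γ N BN =
      β-expand (⟦⟧-candidate A)
        (transport (⟦ A ⟧ e) (sym (exts-[] σ N M)) (⊢-sound ⊢M (∷ₛ-⊨ σ⊨Γ BN)))
    ⊢-sound (⇒E ⊢M ⊢N)                  σ⊨Γ = ⊢-sound ⊢M σ⊨Γ _ (⊢-sound ⊢N σ⊨Γ)
    ⊢-sound (∩I ⊢M ⊢M′)                 σ⊨Γ = ⊢-sound ⊢M σ⊨Γ , ⊢-sound ⊢M′ σ⊨Γ
    ⊢-sound (≤E {A = A} {B} ⊢M A≤B)     σ⊨Γ = ≤⇒⊆ A B A≤B _ (⊢-sound ⊢M σ⊨Γ)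

    ⊢⇒∈⟦⟧ : ∀ {Γ M A} → Γ ⊢ M ∶ A → ⟦ A ⟧ e M
    ⊢⇒∈⟦⟧ {Γ} {M} {A} ⊢M = transport (⟦ A ⟧ e) (subst-var M) (⊢-sound ⊢M (var-⊨ Γ))

theorem34 : (𝒯 : ITT) → ITT.IsSaturated 𝒯 → ITT.IsSensible 𝒯
theorem34 𝒯 (e , Λ⇔∼U , ≤⇒⊆) M Γ A M-uns ⊢M =
  [ proj₁ (Λ⇔∼U A) , ⊆𝒮⇒∼U ]′ (Λ-or-⊆𝒮 (⟦⟧-candidate A))
  where
  open Interpretation 𝒯 e
  open ITT 𝒯 using (_∼_; ⟦_⟧)

  ⊆𝒮⇒∼U : ⟦ A ⟧ e ⊆ 𝒮 → A ∼ U
  ⊆𝒮⇒∼U ⟦A⟧⊆𝒮 = ⊥-elim (⟦A⟧⊆𝒮 M (⊢⇒∈⟦⟧ ≤⇒⊆ ⊢M) M-uns)
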